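{- Let $G$ be a connected finite simple graph that is not a complete graph. Then $\gamma_t(G)=\gamma_{\rm gr}^{\rm Z}(G)=2$ if and only if $N[x]\cup N[y]=V(G)$ holds for every pair of vertices $x,y$ that are not twins.
   Context: $N(v)$ and $N[v]=N(v)\cup\{v\}$ denote open and closed neighborhoods. Two vertices $u,v$ are closed twins if $N[u]=N[v]$, open twins if $N(u)=N(v)$, and twins if they are open or closed twins. A total dominating set is a set $D$ such that every vertex has a neighbor in $D$; $\gamma_t(G)$ is the minimum size of one. A sequence $(v_1,\ldots,v_k)$ of distinct vertices is a Z-sequence if for every $i\in\{1,\ldots,k\}$, $N(v_i)\setminus\bigcup_{j<i}N[v_j]\ne\emptyset$; $\gamma_{\rm gr}^{\rm Z}(G)$ is the maximum length of a Z-sequence. -}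

module Defs where

open import Data.Nat using (ℕ; _≤_; _≥_)
open import Data.Fin using (Fin)
open import Data.List using (List; []; _∷_; length; _++_)
open import Data.List.Membership.Propositional using (_∈_)
open import Data.List.Relation.Unary.Any using (Any)
open import Data.List.Relation.Unary.Unique.Propositional using (Unique)
open import Data.Product using (Σ; ∃; _×_; _,_)
open import Data.Sum using (_⊎_)
open import Relation.Nullary using (¬_; Dec)
open import Relation.Binary.PropositionalEquality using (_≡_)
open import Relation.Binary.Construct.Closure.ReflexiveTransitive using (Star)

record Graph (n : ℕ) : Set₁ where
  field
    Adj     : Fin n → Fin n → Set
    adj?    : ∀ u v → Dec (Adj u v)
    sym     : ∀ {u v} → Adj u v → Adj v u
    irrefl  : ∀ {u} → ¬ Adj u u

module _ {n : ℕ} (G : Graph n) where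
  open Graph G

  N : Fin n → Fin n → Set
  N v w = Adj v w

  N[_] : Fin n → Fin n → Set
  N[ v ] w = w ≡ v ⊎ Adj v w

  Connected : Set
  Connected = ∀ u v → Star Adj u v

  Complete : Set
  Complete = ∀ u v → ¬ u ≡ v → Adj u v

  ClosedTwins : Fin n → Fin n → Set
  ClosedTwins u v = ∀ w → (N[ u ] w → N[ v ] w) × (N[ v ] w → N[ u ] w)

  OpenTwins : Fin n → Fin n → Set
  OpenTwins u v = ∀ w → (N u w → N v w) × (N v w → N u w)

  Twins : Fin n → Fin n → Set
  Twins u v = OpenTwins u v ⊎ ClosedTwins u v

  -- a set of vertices is represented by a duplicate-free list
  IsTotalDominating : List (Fin n) → Set
  IsTotalDominating D = ∀ v → ∃ λ d → d ∈ D × Adj v d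

  TotalDominationNumber : ℕ → Set
  TotalDominationNumber k =
    (Σ (List (Fin n)) λ D → Unique D × IsTotalDominating D × length D ≡ k)
    × (∀ D → Unique D → IsTotalDominating D → k ≤ length D)

  InClosedNbhdOf : List (Fin n) → Fin n → Set
  InClosedNbhdOf P w = Any (λ u → N[ u ] w) P

  -- ZSeqFrom P S : the list S = (v_1,…,v_k) extends the prefix P (listed in order)
  -- so that each v_i has a neighbour outside the closed neighbourhoods of all
  -- earlier vertices.
  ZSeqFrom : List (Fin n) → List (Fin n) → Set
  ZSeqFrom P []      = Data.Unit.⊤ where import Data.Unit
  ZSeqFrom P (v ∷ S) =
    (∃ λ w → N v w × ¬ InClosedNbhdOf P w) × ZSeqFrom (P ++ (v ∷ [])) S

  IsZSequence : List (Fin n) → Set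
  IsZSequence S = Unique S × ZSeqFrom [] S

  ZGrundyNumber : ℕ → Set
  ZGrundyNumber k =
    (Σ (List (Fin n)) λ S → IsZSequence S × length S ≡ k)
    × (∀ S → IsZSequence S → length S ≤ k)

  ClosedNbhdsCover : Fin n → Fin n → Set
  ClosedNbhdsCover x y = ∀ v → N[ x ] v ⊎ N[ y ] v

-- If N[x] ∪ N[y] = V for all non-twins x, y, take an induced path a – b – c (it exists since
-- G is connected but not complete): a and b are not twins, so {a, b} is a total dominating
-- set and (a, b) a Z-sequence, while no Z-sequence reaches length 3 because its first two
-- vertices are already non-twins whose closed neighbourhoods cover G.  Conversely, if a vertex
-- v lies outside N[x] ∪ N[y], a neighbour u of v can always be appended to (x, y), so
-- γ_gr^Z = 2 forces (x, y) not to be a Z-sequence, i.e. N(y) ⊆ N[x]; symmetrically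
-- N(x) ⊆ N[y], which makes x and y twins.
module Submission where

open import Defs
open import Data.Nat using (ℕ; _≤_; s≤s; z≤n)
open import Data.Fin using (Fin; _≟_)
open import Data.Fin.Properties using (all?; ¬∀⟶∃¬)
open import Data.Product using (_×_; _,_; ∃; ∃₂; proj₂)
open import Data.Sum using (inj₁; inj₂)
open import Data.Empty using (⊥-elim)
open import Data.Unit using (tt)
open import Data.List using (List; []; _∷_; length)
open import Data.List.Relation.Unary.Any using (here; there)
open import Data.List.Relation.Unary.All using ([]; _∷_)
open import Data.List.Relation.Unary.AllPairs using ([]; _∷_)
open import Data.List.Membership.Propositional using (_∈_)
open import Relation.Nullary using (¬_; yes; no; Dec; _⊎-dec_)
open import Relation.Binary using (Rel)
open import Relation.Unary using (Pred; Decidable)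
open import Relation.Binary.PropositionalEquality using (_≢_; refl; sym)
open import Relation.Binary.Construct.Closure.ReflexiveTransitive using (Star; ε; _◅_)
open import Function using (_∘_)
open import Function.Bundles using (_⇔_; mk⇔)

distinct-members⇒2≤length : ∀ {A : Set} {x y : A} {xs : List A} →
                            x ∈ xs → y ∈ xs → x ≢ y → 2 ≤ length xs
distinct-members⇒2≤length {xs = _ ∷ []} (here refl) (here refl) x≢y = ⊥-elim (x≢y refl)
distinct-members⇒2≤length {xs = _ ∷ _ ∷ _} _ _ _ = s≤s (s≤s z≤n)

Star-crossing : ∀ {a r p} {A : Set a} {R : Rel A r} {P : Pred A p} → Decidable P →
                ∀ {x v} → Star R x v → P x → ¬ P v → ∃₂ λ y z → R y z × P y × ¬ P z
Star-crossing P? ε Px ¬Pv = ⊥-elim (¬Pv Px)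
Star-crossing P? (_◅_ {j = y} xRy y⋆v) Px ¬Pv with P? y
... | yes Py = Star-crossing P? y⋆v Py ¬Pv
... | no ¬Py = _ , y , xRy , Px , ¬Py

module _ {n : ℕ} (G : Graph n) where
  open Graph G renaming (sym to Adj-sym)

  N[_]? : ∀ x w → Dec (N[_] G x w)
  N[_]? x w = (w ≟ x) ⊎-dec adj? x w

  Adj⇒≢ : ∀ {u v} → Adj u v → u ≢ v
  Adj⇒≢ a refl = irrefl a

  Connected⇒neighbour : Connected G → ∀ {u v} → u ≢ v → ∃ (Adj u)
  Connected⇒neighbour con {u} {v} u≢v with con u v
  ... | ε = ⊥-elim (u≢v refl)
  ... | a ◅ _ = _ , a

  Twins-refl : ∀ x → Twins G x x
  Twins-refl x = inj₂ λ _ → (λ p → p) , (λ p → p)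

  private-neighbour⇒¬Twins : ∀ {x y w} → Adj y w → ¬ N[_] G x w → ¬ Twins G x y
  private-neighbour⇒¬Twins yw x∌w (inj₁ open-twins)   = x∌w (inj₂ (proj₂ (open-twins _) yw))
  private-neighbour⇒¬Twins yw x∌w (inj₂ closed-twins) = x∌w (proj₂ (closed-twins _) (inj₂ yw))

  -- Adjacent x, y become closed twins, non-adjacent ones open twins.
  nested-neighbourhoods⇒Twins : ∀ {x y} → (∀ {w} → Adj x w → N[_] G y w) →
                                (∀ {w} → Adj y w → N[_] G x w) → Twins G x y
  nested-neighbourhoods⇒Twins {x} {y} x⊆y y⊆x with adj? x y
  ... | yes xy = inj₂ λ w → to w , from w
    where
    to : ∀ w → N[_] G x w → N[_] G y w
    to w (inj₁ refl) = inj₂ (Adj-sym xy)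
    to w (inj₂ xw)   = x⊆y xw
    from : ∀ w → N[_] G y w → N[_] G x w
    from w (inj₁ refl) = inj₂ xy
    from w (inj₂ yw)   = y⊆x yw
  ... | no ¬xy = inj₁ λ w → to w , from w
    where
    to : ∀ w → Adj x w → Adj y w
    to w xw with x⊆y xw
    ... | inj₁ refl = ⊥-elim (¬xy xw)
    ... | inj₂ yw   = yw
    from : ∀ w → Adj y w → Adj x w
    from w yw with y⊆x yw
    ... | inj₁ refl = ⊥-elim (¬xy (Adj-sym yw))
    ... | inj₂ xw   = xw

  InducedP₃ : Set
  InducedP₃ = ∃₂ λ a b → ∃ λ c → Adj a b × Adj b c × ¬ N[_] G a c

  ¬Complete⇒¬N[] : ¬ Complete G → ∃₂ λ u v → ¬ N[_] G u v
  ¬Complete⇒¬N[] ¬complete with ¬∀⟶∃¬ n (λ u → ∀ v → N[_] G u v)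
                                   (λ u → all? (N[_]? u))
                                   (λ all-N[] → ¬complete λ u v u≢v → adjacent (all-N[] u v) u≢v)
    where
    adjacent : ∀ {u v} → N[_] G u v → u ≢ v → Adj u v
    adjacent (inj₁ v≡u) u≢v = ⊥-elim (u≢v (sym v≡u))
    adjacent (inj₂ uv)  _   = uv
  ... | u , ¬N[u] = u , ¬∀⟶∃¬ n (N[_] G u) (N[_]? u) ¬N[u]

  -- A walk from u to a vertex outside N[u] leaves N[u] along an edge y – z with y ≠ u.
  Connected∧¬Complete⇒InducedP₃ : Connected G → ¬ Complete G → InducedP₃
  Connected∧¬Complete⇒InducedP₃ con ¬complete with ¬Complete⇒¬N[] ¬complete
  ... | u , v , u∌v with Star-crossing (N[_]? u) (con u v) (inj₁ refl) u∌v
  ... | y , z , yz , inj₁ refl , u∌z = ⊥-elim (u∌z (inj₂ yz))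
  ... | y , z , yz , inj₂ uy   , u∌z = u , y , z , uy , yz , u∌z

  CoverCondition : Set
  CoverCondition = ∀ x y → ¬ Twins G x y → ClosedNbhdsCover G x y

  TotalDominating⇒2≤length : Fin n → ∀ {D} → IsTotalDominating G D → 2 ≤ length D
  TotalDominating⇒2≤length v dominating with dominating v
  ... | d , d∈D , _ with dominating d
  ... | d′ , d′∈D , dd′ = distinct-members⇒2≤length d∈D d′∈D (Adj⇒≢ dd′)

  cover⇒TotalDominating : ∀ {a b} → Adj a b → ClosedNbhdsCover G a b →
                          IsTotalDominating G (a ∷ b ∷ [])
  cover⇒TotalDominating {a} {b} ab cover v with cover v
  ... | inj₁ (inj₁ refl) = b , there (here refl) , ab
  ... | inj₁ (inj₂ av)   = a , here refl , Adj-sym av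
  ... | inj₂ (inj₁ refl) = a , here refl , Adj-sym ab
  ... | inj₂ (inj₂ bv)   = b , there (here refl) , Adj-sym bv

  InducedP₃⇒ZSequence : ∀ {a b c} → Adj a b → Adj b c → ¬ N[_] G a c →
                        IsZSequence G (a ∷ b ∷ [])
  InducedP₃⇒ZSequence ab bc a∌c =
    ((Adj⇒≢ ab ∷ []) ∷ [] ∷ []) ,
    (_ , ab , λ ()) , (_ , bc , λ { (here a∋c) → a∌c a∋c }) , tt

  cover⇒ZSequence-length≤2 : CoverCondition → ∀ S → IsZSequence G S → length S ≤ 2
  cover⇒ZSequence-length≤2 _ []          _ = z≤n
  cover⇒ZSequence-length≤2 _ (_ ∷ [])     _ = s≤s z≤n
  cover⇒ZSequence-length≤2 _ (_ ∷ _ ∷ []) _ = s≤s (s≤s z≤n)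
  cover⇒ZSequence-length≤2 cover (v₁ ∷ v₂ ∷ _ ∷ _)
    (_ , _ , (w₂ , v₂w₂ , v₁∌w₂) , (w₃ , _ , v₁v₂∌w₃) , _)
    with cover v₁ v₂ (private-neighbour⇒¬Twins v₂w₂ (λ v₁∋w₂ → v₁∌w₂ (here v₁∋w₂))) w₃
  ... | inj₁ v₁∋w₃ = ⊥-elim (v₁v₂∌w₃ (here v₁∋w₃))
  ... | inj₂ v₂∋w₃ = ⊥-elim (v₁v₂∌w₃ (there (here v₂∋w₃)))

  -- If N(y) ⊄ N[x] and some v lies outside N[x] ∪ N[y], then (x, y, u) is a Z-sequence
  -- for any neighbour u of v.
  ZSequence-length≤2⇒nested : Connected G → (∀ S → IsZSequence G S → length S ≤ 2) →
                              ∀ {x y v} → x ≢ y → ¬ N[_] G x v → ¬ N[_] G y v →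
                              ∀ {w} → Adj y w → N[_] G x w
  ZSequence-length≤2⇒nested con short {x} {y} {v} x≢y x∌v y∌v {w} yw
    with N[_]? x w | Connected⇒neighbour con {x} x≢y | Connected⇒neighbour con {v} {x} (x∌v ∘ inj₁)
  ... | yes x∋w | _ | _ = x∋w
  ... | no x∌w | _ , xx′ | u , vu with short (x ∷ y ∷ u ∷ []) Z-sequence
    where
    u≢ : ∀ {z} → ¬ N[_] G z v → z ≢ u
    u≢ z∌v refl = z∌v (inj₂ (Adj-sym vu))
    Z-sequence : IsZSequence G (x ∷ y ∷ u ∷ [])
    Z-sequence =
      ((x≢y ∷ u≢ x∌v ∷ []) ∷ (u≢ y∌v ∷ []) ∷ [] ∷ []) ,
      (_ , xx′ , λ ()) ,
      (w , yw , λ { (here x∋w) → x∌w x∋w }) ,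
      (v , Adj-sym vu , λ { (here x∋v) → x∌v x∋v ; (there (here y∋v)) → y∌v y∋v }) , tt
  ... | s≤s (s≤s ())

  ZSequence-length≤2⇒cover : Connected G → (∀ S → IsZSequence G S → length S ≤ 2) →
                             CoverCondition
  ZSequence-length≤2⇒cover con short x y ¬twins v with N[_]? x v | N[_]? y v
  ... | yes x∋v | _        = inj₁ x∋v
  ... | no _    | yes y∋v  = inj₂ y∋v
  ... | no x∌v  | no y∌v   = ⊥-elim (¬twins (nested-neighbourhoods⇒Twins
        (ZSequence-length≤2⇒nested con short (x≢y ∘ sym) y∌v x∌v)
        (ZSequence-length≤2⇒nested con short x≢y x∌v y∌v)))
    where
    x≢y : x ≢ y
    x≢y refl = ¬twins (Twins-refl x)

  cover⇒TotalDomination≡2∧ZGrundy≡2 : Connected G → ¬ Complete G → CoverCondition →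
                                      TotalDominationNumber G 2 × ZGrundyNumber G 2
  cover⇒TotalDomination≡2∧ZGrundy≡2 con ¬complete cover
    with Connected∧¬Complete⇒InducedP₃ con ¬complete
  ... | a , b , c , ab , bc , a∌c =
    ( ((a ∷ b ∷ []) , (Adj⇒≢ ab ∷ []) ∷ [] ∷ [] , dominating , refl)
    , (λ _ _ → TotalDominating⇒2≤length a) )
    , ( ((a ∷ b ∷ []) , InducedP₃⇒ZSequence ab bc a∌c , refl)
      , cover⇒ZSequence-length≤2 cover )
    where
    dominating : IsTotalDominating G (a ∷ b ∷ [])
    dominating = cover⇒TotalDominating ab (cover a b (private-neighbour⇒¬Twins bc a∌c))

proposition3p4 : (n : ℕ) (G : Graph n) → Connected G → ¬ Complete G →
    ((TotalDominationNumber G 2 × ZGrundyNumber G 2) ⇔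
     (∀ x y → ¬ Twins G x y → ClosedNbhdsCover G x y))
proposition3p4 n G con ¬complete = mk⇔
  (λ (_ , _ , short) → ZSequence-length≤2⇒cover G con short)
  (cover⇒TotalDomination≡2∧ZGrundy≡2 G con ¬complete)
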